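{- Let $g$ be an even positive integer, and consider the metric space $(\mathbf{Z},d_g)$ associated with the generating set $A_g=\{0\}\cup\{\pm g^i:i=0,1,2,\ldots\}$. For every nonnegative integer $h$, the set \[ C=\bigcup_{q=0}^{\infty} S_e((2h+1)q) \] is an $h$-net in $(\mathbf{Z},d_g)$.
   Context: The word length $\ell_g(n)$ of an integer $n$ is $0$ if $n=0$, and otherwise the least positive integer $r$ such that $n$ is a sum of $r$ elements of $A_g$. The metric is $d_g(m,n)=\ell_g(m-n)$. Here $e=0$ is the identity of $\mathbf{Z}$ and $S_e(m)=\{n\in\mathbf{Z}:\ell_g(n)=m\}$. An $h$-net in $(\mathbf{Z},d_g)$ is a subset $C$ such that for every $n\in\mathbf{Z}$ there is $z\in C$ with $d_g(n,z)\le h$. -}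

module Defs where

open import Data.Nat as ℕ using (ℕ; zero; suc)
open import Data.Integer using (ℤ; +_; -_; 0ℤ)
open import Data.List using (List; length; foldr)
open import Data.List.Relation.Unary.All using (All)
open import Data.Product using (Σ; ∃; ∃-syntax; _×_; _,_)
open import Data.Sum using (_⊎_)
open import Relation.Binary.PropositionalEquality using (_≡_)
open import Relation.Nullary using (¬_)

InA : ℕ → ℤ → Set
InA g a = (a ≡ 0ℤ) ⊎ (∃[ i ] ((a ≡ + (g ℕ.^ i)) ⊎ (a ≡ - (+ (g ℕ.^ i)))))

SumOf : ℕ → ℕ → ℤ → Set
SumOf g r n = Σ (List ℤ) λ xs → (length xs ≡ r) × All (InA g) xs × (foldr Data.Integer._+_ 0ℤ xs ≡ n)

WordLength : ℕ → ℤ → ℕ → Set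
WordLength g n m =
  ((n ≡ 0ℤ) × (m ≡ 0))
  ⊎ (¬ (n ≡ 0ℤ) × (1 ℕ.≤ m) × SumOf g m n
       × (∀ r → 1 ℕ.≤ r → r ℕ.< m → ¬ SumOf g r n))

Dist : ℕ → ℤ → ℤ → ℕ → Set
Dist g m n k = WordLength g (m Data.Integer.- n) k

InSphere : ℕ → ℕ → ℤ → Set
InSphere g m n = WordLength g n m

IsNet : ℕ → ℕ → (ℤ → Set) → Set
IsNet g h C = ∀ (n : ℤ) → ∃[ z ] (C z × ∃[ k ] ((k ℕ.≤ h) × Dist g n z k))

CSet : ℕ → ℕ → ℤ → Set
CSet g h z = ∃[ q ] InSphere g ((2 ℕ.* h ℕ.+ 1) ℕ.* q) z

module Submission where

-- The word length ℓ_g is computed explicitly.  For g ≥ 2 let wl : ℕ → ℕ be given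
-- by the last base-g digit: wl (r + q g) is the least of r + wl q (r copies of 1
-- and g times a word for q) and (g - r) + wl (q + 1) (g - r copies of -1 and g
-- times a word for q + 1).  Writing len n = wl |n|:
--   * upper bound: n is a sum of len n generators (strong induction on |n|);
--   * lower bound: adding a generator changes len by at most one (wl moves by at
--     most one under n ↦ n + g^i and under the reflection n ↦ g^i - n), so every
--     sum of r generators has len ≤ r.
-- Hence len = ℓ_g.  Cutting a shortest word gives "descend": if ℓ(n) = m + s then
-- some y has ℓ(y) = m and d(n, y) ≤ s.  For even g = 2·half, adding g^(K+1) to
-- any n ≤ half·g^K raises wl by exactly one; this gives "ascend": some z has
-- ℓ(z) = ℓ(n) + s and d(n, z) ≤ s.  Writing ℓ(n) = q(2h + 1) + r, descend r
-- steps when r ≤ h and ascend 2h + 1 - r ≤ h steps otherwise.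

open import Defs
open import Data.Nat using (ℕ; _%_; _<_)
open import Data.Product using (_,_)
open import Relation.Binary.PropositionalEquality using (_≡_; refl)

module BaseExpansion (b : ℕ) .{{_ : Data.Nat.NonZero b}} where

  open import Data.Nat
  open import Data.Nat.Properties
  open import Data.Nat.DivMod
  open import Data.Product using (_×_; _,_)
  open import Relation.Binary.PropositionalEquality

  data Digits : ℕ → Set where
    digits : ∀ r q → r < b → Digits (r + q * b)

  digitsOf : ∀ n → Digits n
  digitsOf n = subst Digits (sym (m≡m%n+[m/n]*n n b)) (digits (n % b) (n / b) (m%n<n n b))

  digit-% : ∀ {r} q → r < b → (r + q * b) % b ≡ r
  digit-% {r} q r<b = trans ([m+kn]%n≡m%n r q b) (m<n⇒m%n≡m r<b)

  digit-/ : ∀ {r} q → r < b → (r + q * b) / b ≡ q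
  digit-/ {r} q r<b = begin
    (r + q * b) / b        ≡⟨ +-distrib-/ r (q * b) digit-sum<b ⟩
    r / b + q * b / b      ≡⟨ cong₂ _+_ (m<n⇒m/n≡0 r<b) (m*n/n≡m q b) ⟩
    q                      ∎
    where
    open ≡-Reasoning
    digit-sum<b : r % b + (q * b) % b < b
    digit-sum<b = subst (_< b) (sym (trans (cong₂ _+_ (m<n⇒m%n≡m r<b) (m*n%n≡0 q b)) (+-identityʳ r))) r<b

  digits-injective : ∀ {r r' q q'} → r < b → r' < b → r + q * b ≡ r' + q' * b → r ≡ r' × q ≡ q'
  digits-injective {q = q} {q'} r<b r'<b eq =
    trans (sym (digit-% q r<b)) (trans (cong (_% b) eq) (digit-% q' r'<b)) ,
    trans (sym (digit-/ q r<b)) (trans (cong (_/ b) eq) (digit-/ q' r'<b))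

  quot-≤ : ∀ {r q} m → r + q * b ≤ m * b → q ≤ m
  quot-≤ {r} {q} m le = *-cancelʳ-≤ q m b (≤-trans (m≤n+m (q * b) r) le)

  quot-< : ∀ {r q} m → 0 < r → r + q * b ≤ m * b → q < m
  quot-< {suc r} {q} m _ le = *-cancelʳ-< b q m (≤-trans (s≤s (m≤n+m (q * b) r)) le)

-- The candidate word-length function wl on ℕ for a base g = c + 2 ≥ 2,
-- computed from the last base-g digit: r + q * g is written either as r copies
-- of +1 plus g·(a word for q), or as g - r copies of -1 plus g·(a word for q+1).
module WordLengthFunction (c : ℕ) where

  open import Data.Nat
  open import Data.Nat.Properties
  open import Data.Nat.DivMod
  open import Relation.Binary.PropositionalEquality

  g : ℕ
  g = suc (suc c)

  open BaseExpansion g public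

  1<g : 1 < g
  1<g = s≤s (s≤s z≤n)

  -- Cost of the number with last digit d, given the costs a of the quotient q
  -- and b of q + 1 (for d = 0 only the first option is needed).
  digitCost : ℕ → ℕ → ℕ → ℕ
  digitCost zero    a b = a
  digitCost (suc d) a b = (suc d + a) ⊓ ((g ∸ suc d) + b)

  digitCost-cong : ∀ d {a a' b b'} → a ≡ a' → (0 < d → b ≡ b') → digitCost d a b ≡ digitCost d a' b'
  digitCost-cong zero    a≡a' _     = a≡a'
  digitCost-cong (suc d) a≡a' b≡b' =
    cong₂ (λ x y → (suc d + x) ⊓ ((g ∸ suc d) + y)) a≡a' (b≡b' (s≤s z≤n))

  quot< : ∀ r q → 0 < r + q * g → q < r + q * g
  quot< r zero    0<r = 0<r
  quot< r (suc q) _   = ≤-trans (s≤s (s≤s (≤-trans (m≤m*n q g) (m≤n+m (q * g) c)))) (m≤n+m _ r)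

  quot+1< : ∀ r q → 0 < r → 2 ≤ r + q * g → suc q < r + q * g
  quot+1< r       zero     _       2≤r = 2≤r
  quot+1< (suc r) (suc q) _ _ =
    s≤s (≤-trans (s≤s (s≤s (≤-trans (m≤m*n q g) (m≤n+m (q * g) c)))) (m≤n+m _ r))

  suc-div< : ∀ n → 2 ≤ n → 0 < n % g → suc (n / g) < n
  suc-div< n 2≤n d>0 = subst (suc (n / g) <_) (sym n≡) (quot+1< (n % g) (n / g) d>0 (subst (2 ≤_) n≡ 2≤n))
    where
    n≡ : n ≡ n % g + n / g * g
    n≡ = m≡m%n+[m/n]*n n g

  -- wl with explicit fuel; the recursive calls are at n / g and n / g + 1 < n.
  wlFuel : ℕ → ℕ → ℕ
  wlFuel zero    _                = 0
  wlFuel (suc k) zero             = 0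
  wlFuel (suc k) (suc zero)       = 1
  wlFuel (suc k) n@(suc (suc _)) = digitCost (n % g) (wlFuel k (n / g)) (wlFuel k (suc (n / g)))

  wl : ℕ → ℕ
  wl n = wlFuel (suc n) n

  fuel-irrelevant : ∀ k k' n → n < k → n < k' → wlFuel k n ≡ wlFuel k' n
  fuel-irrelevant (suc k) (suc k') zero             _           _            = refl
  fuel-irrelevant (suc k) (suc k') (suc zero)       _           _            = refl
  fuel-irrelevant (suc k) (suc k') n@(suc (suc _)) (s≤s n≤k) (s≤s n≤k') =
    digitCost-cong (n % g) (agree (n / g) (m/n<m n g 1<g))
                           (λ d>0 → agree (suc (n / g)) (suc-div< n (s≤s (s≤s z≤n)) d>0))
    where
    agree : ∀ m → m < n → wlFuel k m ≡ wlFuel k' m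
    agree m m<n = fuel-irrelevant k k' m (<-≤-trans m<n n≤k) (<-≤-trans m<n n≤k')

  wl-unfold : ∀ n → 2 ≤ n → wl n ≡ digitCost (n % g) (wl (n / g)) (wl (suc (n / g)))
  wl-unfold (suc zero)       (s≤s ())
  wl-unfold n@(suc (suc _)) _ =
    digitCost-cong (n % g) (fuel-irrelevant n _ (n / g) (m/n<m n g 1<g) ≤-refl)
                           (λ d>0 → fuel-irrelevant n _ (suc (n / g))
                                      (suc-div< n (s≤s (s≤s z≤n)) d>0) ≤-refl)

  wl-digit-≥2 : ∀ {r} q → r < g → 2 ≤ r + q * g → wl (r + q * g) ≡ digitCost r (wl q) (wl (suc q))
  wl-digit-≥2 q r<g 2≤n =
    trans (wl-unfold _ 2≤n) (cong₂ (λ d m → digitCost d (wl m) (wl (suc m))) (digit-% q r<g) (digit-/ q r<g))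

  wl-digit : ∀ r q → r < g → wl (r + q * g) ≡ digitCost r (wl q) (wl (suc q))
  wl-digit zero          zero    _   = refl
  wl-digit (suc zero)    zero    _   = refl
  wl-digit (suc (suc r)) q       r<g = wl-digit-≥2 q r<g (s≤s (s≤s z≤n))
  wl-digit zero          (suc q) r<g = wl-digit-≥2 (suc q) r<g (≤-trans 1<g (m≤m+n g (q * g)))
  wl-digit (suc zero)    (suc q) r<g = wl-digit-≥2 (suc q) r<g (s≤s (≤-trans (s≤s z≤n) (m≤m+n g (q * g))))

module WordLengthLipschitz (c : ℕ) where

  open import Data.Nat
  open import Data.Nat.Properties
  open import Data.Nat.Induction using (<-rec)
  open import Data.Nat.Tactic.RingSolver using (solve-∀)
  open import Data.Product using (_×_; _,_; proj₁; proj₂)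
  open import Data.Sum using (_⊎_; inj₁; inj₂)
  open import Relation.Nullary using (yes; no; contradiction)
  open import Relation.Binary.PropositionalEquality
  open WordLengthFunction c

  infix 4 _≈₁_
  _≈₁_ : ℕ → ℕ → Set
  x ≈₁ y = x ≤ suc y × y ≤ suc x

  ≈₁-cast : ∀ {x x' y y'} → x ≡ x' → y ≡ y' → x' ≈₁ y' → x ≈₁ y
  ≈₁-cast refl refl x≈y = x≈y

  ≈₁-⊓ : ∀ {x x' y y'} → x ≈₁ x' → y ≈₁ y' → (x ⊓ y) ≈₁ (x' ⊓ y')
  ≈₁-⊓ (x≤ , x'≤) (y≤ , y'≤) = ⊓-mono-≤ x≤ y≤ , ⊓-mono-≤ x'≤ y'≤

  ≈₁-+ˡ : ∀ k {x x'} → x ≈₁ x' → (k + x) ≈₁ (k + x')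
  ≈₁-+ˡ k {x} {x'} (x≤ , x'≤) =
    subst (k + x ≤_) (+-suc k x') (+-monoʳ-≤ k x≤) , subst (k + x' ≤_) (+-suc k x) (+-monoʳ-≤ k x'≤)

  ⊓-shift : ∀ x y → (suc x ⊓ y) ≈₁ (x ⊓ suc y)
  ⊓-shift x y =
    ⊓-mono-≤ ≤-refl (≤-trans (n≤1+n y) (n≤1+n _)) , ⊓-mono-≤ (≤-trans (n≤1+n x) (n≤1+n _)) ≤-refl

  digitCost-≈₁ : ∀ d {a a' b b'} → a ≈₁ a' → b ≈₁ b' → digitCost d a b ≈₁ digitCost d a' b'
  digitCost-≈₁ zero    a≈ _  = a≈
  digitCost-≈₁ (suc d) a≈ b≈ = ≈₁-⊓ (≈₁-+ˡ (suc d) a≈) (≈₁-+ˡ (g ∸ suc d) b≈)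

  -- The three ways n ↦ n + 1 acts on the last digit: 0 ↦ 1, d ↦ d + 1 with
  -- 1 ≤ d and d + 1 < g, and the carry g - 1 ↦ 0.
  digitCost-0↦1 : ∀ a b → a ≤ suc b → digitCost 1 a b ≈₁ a
  digitCost-0↦1 a b a≤1+b =
    m⊓n≤m _ _ , ⊓-glb (≤-trans (n≤1+n _) (n≤1+n _)) (≤-trans a≤1+b (s≤s (m≤n+m _ (suc c))))

  digitCost-d↦d+1 : ∀ d a b → suc (suc d) < g → digitCost (suc (suc d)) a b ≈₁ digitCost (suc d) a b
  digitCost-d↦d+1 d a b d+2<g =
    subst (λ e → (suc (suc d) + a) ⊓ ((g ∸ suc (suc d)) + b) ≈₁ (suc d + a) ⊓ (e + b))
          (sym (+-∸-assoc 1 d≤c)) (⊓-shift (suc d + a) ((g ∸ suc (suc d)) + b))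
    where
    d≤c : d ≤ c
    d≤c = ≤-pred (≤-pred (<⇒≤ d+2<g))

  digitCost-carry : ∀ a b → b ≤ suc a → b ≈₁ digitCost (suc c) a b
  digitCost-carry a b b≤1+a =
    subst (λ e → b ≈₁ (suc c + a) ⊓ (e + b)) (sym (m+n∸n≡m 1 c))
          (⊓-glb (≤-trans b≤1+a (s≤s (m≤n+m _ (suc c)))) (≤-trans (n≤1+n _) (n≤1+n _)) , m⊓n≤n _ _)

  -- wl (n + 1) and wl n differ by at most one; by strong induction on n, since
  -- only the digit 0 ↦ 1 and the carry need the claim for the quotient.
  wl-suc-≈₁ : ∀ n → wl (suc n) ≈₁ wl n
  wl-suc-≈₁ = <-rec _ step
    where
    step : ∀ n → (∀ {m} → m < n → wl (suc m) ≈₁ wl m) → wl (suc n) ≈₁ wl n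
    step n ih with digitsOf n
    ... | digits r q r<g with m≤n⇒m<n∨m≡n r<g
    ...   | inj₂ refl =
      ≈₁-cast (wl-digit 0 (suc q) (s≤s z≤n)) (wl-digit (suc c) q r<g)
              (digitCost-carry (wl q) (wl (suc q)) (proj₁ (ih (quot< (suc c) q (s≤s z≤n)))))
    ...   | inj₁ r+1<g with r | q
    ...     | zero    | zero   = s≤s z≤n , z≤n
    ...     | zero    | suc q' =
      ≈₁-cast (wl-digit 1 (suc q') 1<g) (wl-digit 0 (suc q') (s≤s z≤n))
              (digitCost-0↦1 (wl (suc q')) (wl (suc (suc q')))
                (proj₂ (ih (quot< 0 (suc q') (s≤s z≤n)))))
    ...     | suc d   | q'     =
      ≈₁-cast (wl-digit (suc (suc d)) q' r+1<g) (wl-digit (suc d) q' r<g)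
              (digitCost-d↦d+1 d (wl q') (wl (suc q')) r+1<g)

  add-to-quotient : ∀ r q p → r + q * g + g * p ≡ r + (q + p) * g
  add-to-quotient = solve-∀

  -- Adding g ^ i shifts the quotient by g ^ (i - 1), so induction on i reduces to wl-suc-≈₁.
  wl-+pow-≈₁ : ∀ i n → wl (n + g ^ i) ≈₁ wl n
  wl-+pow-≈₁ zero    n = ≈₁-cast (cong wl (+-comm n 1)) refl (wl-suc-≈₁ n)
  wl-+pow-≈₁ (suc i) n with digitsOf n
  ... | digits r q r<g =
    ≈₁-cast (trans (cong wl (add-to-quotient r q (g ^ i))) (wl-digit r (q + g ^ i) r<g)) (wl-digit r q r<g)
            (digitCost-≈₁ r (wl-+pow-≈₁ i q) (wl-+pow-≈₁ i (suc q)))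

  add-expansions : ∀ r r' q q' → r + q * g + (r' + q' * g) ≡ (r + r') + (q + q') * g
  add-expansions = solve-∀

  digit-sum-carry : ∀ {r r' q q' p} → r < g → r' < g → r + q * g + (r' + q' * g) ≡ p * g →
                    (r ≡ 0 × r' ≡ 0 × q + q' ≡ p) ⊎ (r + r' ≡ g × suc (q + q') ≡ p)
  digit-sum-carry {r} {r'} {q} {q'} {p} r<g r'<g sum≡ with r + r' <? g
  ... | yes r+r'<g =
    let (r+r'≡0 , q+q'≡p) =
          digits-injective r+r'<g (s≤s z≤n) (trans (sym (add-expansions r r' q q')) sum≡)
    in inj₁ (m+n≡0⇒m≡0 r r+r'≡0 , m+n≡0⇒n≡0 r r+r'≡0 , q+q'≡p)
  ... | no r+r'≮g =
    let (excess≡0 , 1+q+q'≡p) = digits-injective excess<g (s≤s z≤n) carried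
    in inj₂ (trans (sym (m∸n+n≡m g≤r+r')) (cong (_+ g) excess≡0) , 1+q+q'≡p)
    where
    g≤r+r' : g ≤ r + r'
    g≤r+r' = ≮⇒≥ r+r'≮g
    excess<g : r + r' ∸ g < g
    excess<g = subst (r + r' ∸ g <_) (m+n∸n≡m g g) (∸-monoˡ-< (+-mono-< r<g r'<g) g≤r+r')
    carried : (r + r' ∸ g) + suc (q + q') * g ≡ 0 + p * g
    carried = begin
      (r + r' ∸ g) + (g + (q + q') * g) ≡⟨ sym (+-assoc (r + r' ∸ g) g _) ⟩
      (r + r' ∸ g) + g + (q + q') * g   ≡⟨ cong (_+ (q + q') * g) (m∸n+n≡m g≤r+r') ⟩
      (r + r') + (q + q') * g           ≡⟨ sym (add-expansions r r' q q') ⟩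
      r + q * g + (r' + q' * g)         ≡⟨ sum≡ ⟩
      p * g                             ∎
      where open ≡-Reasoning

  -- The carry case of the reflection: digits r, r' with r + r' = g exchange the
  -- two options of digitCost.
  digitCost-reflect : ∀ r r' {a b a' b'} → r < g → r' < g → r + r' ≡ g →
                      a' ≤ suc b → b' ≤ suc a → digitCost r' a' b' ≤ suc (digitCost r a b)
  digitCost-reflect zero    r'       r<g r'<g refl _ _ = contradiction r'<g (<-irrefl refl)
  digitCost-reflect (suc s) zero     r<g r'<g r+r'≡g _ _ =
    contradiction r<g (<-irrefl (trans (sym (+-identityʳ _)) r+r'≡g))
  digitCost-reflect (suc s) (suc s') {a} {b} {a'} {b'} r<g r'<g r+r'≡g a'≤1+b b'≤1+a =
    subst₂ (λ x y → (suc s' + a') ⊓ (x + b') ≤ suc ((suc s + a) ⊓ (y + b))) (sym g-r'≡r) (sym g-r≡r') (begin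
      (suc s' + a') ⊓ (suc s + b')
        ≤⟨ ⊓-mono-≤ (+-monoʳ-≤ (suc s') a'≤1+b) (+-monoʳ-≤ (suc s) b'≤1+a) ⟩
      (suc s' + suc b) ⊓ (suc s + suc a)
        ≡⟨ cong₂ _⊓_ (+-suc (suc s') b) (+-suc (suc s) a) ⟩
      suc ((suc s' + b) ⊓ (suc s + a))
        ≡⟨ cong suc (⊓-comm _ _) ⟩
      suc ((suc s + a) ⊓ (suc s' + b))  ∎)
    where
    open ≤-Reasoning
    g-r≡r' : g ∸ suc s ≡ suc s'
    g-r≡r' = trans (cong (_∸ suc s) (sym r+r'≡g)) (m+n∸m≡n (suc s) (suc s'))
    g-r'≡r : g ∸ suc s' ≡ suc s
    g-r'≡r = trans (cong (_∸ suc s') (sym r+r'≡g)) (m+n∸n≡m (suc s) (suc s'))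

  wl-reflect : ∀ i a b → a + b ≡ g ^ i → wl b ≤ suc (wl a)
  wl-reflect zero    zero       (suc zero) refl = s≤s z≤n
  wl-reflect zero    (suc zero) zero       refl = z≤n
  wl-reflect (suc i) a          b          a+b≡ with digitsOf a | digitsOf b
  ... | digits r q r<g | digits r' q' r'<g
      with digit-sum-carry {q = q} {q'} r<g r'<g (trans a+b≡ (*-comm g (g ^ i)))
  ... | inj₁ (refl , refl , q+q'≡) =
    subst₂ (λ x y → x ≤ suc y) (sym (wl-digit 0 q' (s≤s z≤n))) (sym (wl-digit 0 q (s≤s z≤n)))
           (wl-reflect i q q' q+q'≡)
  ... | inj₂ (r+r'≡g , 1+q+q'≡) =
    subst₂ (λ x y → x ≤ suc y) (sym (wl-digit r' q' r'<g)) (sym (wl-digit r q r<g))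
           (digitCost-reflect r r' r<g r'<g r+r'≡g (wl-reflect i (suc q) q' 1+q+q'≡)
                                                 (wl-reflect i q (suc q') (trans (+-suc q q') 1+q+q'≡)))

module GeneratorSums (g : ℕ) where

  open import Data.Nat as ℕ using (zero; suc)
  open import Data.Nat.Properties using (suc-injective)
  open import Data.Integer using (ℤ; +_; -_; 0ℤ; _+_; _*_)
  open import Data.Integer.Properties
    using (+-identityˡ; +-assoc; neg-involutive; neg-distrib-+; pos-*; neg-distribʳ-*; *-zeroʳ; *-distribˡ-+)
  open import Data.List using ([]; _∷_)
  open import Data.List.Relation.Unary.All using ([]; _∷_)
  open import Data.Product using (Σ-syntax; _×_; _,_)
  open import Data.Sum using (inj₁; inj₂)
  open import Relation.Binary.PropositionalEquality

  inA-one : InA g (+ 1)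
  inA-one = inj₂ (0 , inj₁ refl)

  inA-neg : ∀ {a} → InA g a → InA g (- a)
  inA-neg (inj₁ refl)             = inj₁ refl
  inA-neg (inj₂ (i , inj₁ refl)) = inj₂ (i , inj₂ refl)
  inA-neg (inj₂ (i , inj₂ refl)) = inj₂ (i , inj₁ (neg-involutive _))

  inA-scale : ∀ {a} → InA g a → InA g (+ g * a)
  inA-scale (inj₁ refl)             = inj₁ (*-zeroʳ (+ g))
  inA-scale (inj₂ (i , inj₁ refl)) = inj₂ (suc i , inj₁ (sym (pos-* g (g ℕ.^ i))))
  inA-scale (inj₂ (i , inj₂ refl)) =
    inj₂ (suc i , inj₂ (trans (sym (neg-distribʳ-* (+ g) (+ (g ℕ.^ i)))) (cong -_ (sym (pos-* g (g ℕ.^ i))))))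

  sum-[] : SumOf g 0 0ℤ
  sum-[] = [] , refl , [] , refl

  sum-∷ : ∀ {r a x} → InA g a → SumOf g r x → SumOf g (suc r) (a + x)
  sum-∷ {a = a} a∈A (as , refl , as∈A , refl) = (a ∷ as) , refl , a∈A ∷ as∈A , refl

  sum-ones : ∀ k → SumOf g k (+ k)
  sum-ones zero    = sum-[]
  sum-ones (suc k) = sum-∷ inA-one (sum-ones k)

  sum-++ : ∀ {r r' x y} → SumOf g r x → SumOf g r' y → SumOf g (r ℕ.+ r') (x + y)
  sum-++ {r' = r'} {y = y} ([] , refl , [] , refl) S = subst (SumOf g r') (sym (+-identityˡ y)) S
  sum-++ {y = y} ((a ∷ as) , refl , (a∈A ∷ as∈A) , refl) S =
    subst (SumOf g _) (sym (+-assoc a _ y)) (sum-∷ a∈A (sum-++ (as , refl , as∈A , refl) S))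

  sum-split : ∀ r r' {x} → SumOf g (r ℕ.+ r') x →
              Σ[ y ∈ ℤ ] Σ[ w ∈ ℤ ] SumOf g r y × SumOf g r' w × y + w ≡ x
  sum-split zero    r' {x} S = 0ℤ , x , sum-[] , S , +-identityˡ x
  sum-split (suc r) r' ((a ∷ as) , len≡ , (a∈A ∷ as∈A) , refl)
    with sum-split r r' (as , suc-injective len≡ , as∈A , refl)
  ... | y , w , Sy , Sw , y+w≡ =
    a + y , w , sum-∷ a∈A Sy , Sw , trans (+-assoc a y w) (cong (λ v → a + v) y+w≡)

  sum-zero : ∀ {x} → SumOf g 0 x → x ≡ 0ℤ
  sum-zero ([] , refl , [] , refl) = refl

  module _ (φ : ℤ → ℤ) (φ-0 : φ 0ℤ ≡ 0ℤ) (φ-+ : ∀ x y → φ (x + y) ≡ φ x + φ y)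
           (φ-A : ∀ {a} → InA g a → InA g (φ a)) where

    sum-map : ∀ {r x} → SumOf g r x → SumOf g r (φ x)
    sum-map ([] , refl , [] , refl) = subst (SumOf g 0) (sym φ-0) sum-[]
    sum-map ((a ∷ as) , refl , (a∈A ∷ as∈A) , refl) =
      subst (SumOf g _) (sym (φ-+ a _)) (sum-∷ (φ-A a∈A) (sum-map (as , refl , as∈A , refl)))

  sum-neg : ∀ {r x} → SumOf g r x → SumOf g r (- x)
  sum-neg = sum-map -_ refl neg-distrib-+ inA-neg

  sum-scale : ∀ {r x} → SumOf g r x → SumOf g r (+ g * x)
  sum-scale = sum-map (+ g *_) (*-zeroʳ (+ g)) (*-distribˡ-+ (+ g)) inA-scale

module IntegerWordLength (c : ℕ) where

  open import Data.Nat as ℕ using (zero; suc; z≤n; s≤s; _∸_; _^_)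
  import Data.Nat.Properties as ℕ
  open import Data.Nat.Induction using (<-rec)
  import Data.Nat.Tactic.RingSolver as ℕ-Solver
  open import Data.Integer using (ℤ; +_; -[1+_]; -_; 0ℤ; _+_; _-_; _*_; ∣_∣; _≟_)
  open import Data.Integer.Properties
    using (+-identityˡ; +-comm; +-injective; ∣-i∣≡∣i∣; ⊖-≥; ⊖-<; pos-*; pos-+)
  import Data.Integer.Tactic.RingSolver as ℤ-Solver
  open import Data.List using ([]; _∷_; length; foldr)
  open import Data.List.Relation.Unary.All using (All; []; _∷_)
  open import Data.Product using (Σ-syntax; _×_; _,_; proj₁; proj₂)
  open import Data.Sum using (_⊎_; inj₁; inj₂)
  open import Relation.Nullary using (yes; no)
  open import Relation.Binary.PropositionalEquality
  open WordLengthFunction c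
  open WordLengthLipschitz c
  open GeneratorSums g

  len : ℤ → ℕ
  len n = wl ∣ n ∣

  ∣+∣-cases : ∀ s p → (∣ s + + p ∣ ≡ ∣ s ∣ ℕ.+ p) ⊎ (∣ s ∣ ≡ ∣ s + + p ∣ ℕ.+ p)
                                                  ⊎ (∣ s ∣ ℕ.+ ∣ s + + p ∣ ≡ p)
  ∣+∣-cases (+ a)    p = inj₁ refl
  ∣+∣-cases -[1+ a ] p with suc a ℕ.≤? p
  ... | yes 1+a≤p =
    inj₂ (inj₂ (trans (cong (λ z → suc a ℕ.+ ∣ z ∣) (⊖-≥ 1+a≤p)) (ℕ.m+[n∸m]≡n 1+a≤p)))
  ... | no  1+a≰p =
    inj₂ (inj₁ (trans (sym (ℕ.m∸n+n≡m (ℕ.<⇒≤ p<1+a)))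
                      (cong (ℕ._+ p) (trans (sym (∣-i∣≡∣i∣ (+ (suc a ∸ p)))) (cong ∣_∣ (sym (⊖-< p<1+a)))))))
    where
    p<1+a : p ℕ.< suc a
    p<1+a = ℕ.≰⇒> 1+a≰p

  len-+pow : ∀ i s → len (s + + (g ^ i)) ℕ.≤ suc (len s)
  len-+pow i s with ∣+∣-cases s (g ^ i)
  ... | inj₁ s+p≡ =
    subst (λ k → wl k ℕ.≤ suc (len s)) (sym s+p≡) (proj₁ (wl-+pow-≈₁ i ∣ s ∣))
  ... | inj₂ (inj₁ s≡) =
    subst (λ k → len (s + + (g ^ i)) ℕ.≤ suc (wl k)) (sym s≡) (proj₂ (wl-+pow-≈₁ i ∣ s + + (g ^ i) ∣))
  ... | inj₂ (inj₂ reflected) = wl-reflect i ∣ s ∣ ∣ s + + (g ^ i) ∣ reflected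

  -- Adding -x to s is adding x to -s, up to the symmetry n ↦ -n of len.
  neg-swap : ∀ x s → - (- x + s) ≡ - s + x
  neg-swap = ℤ-Solver.solve-∀

  len-+generator : ∀ {a} s → InA g a → len (a + s) ℕ.≤ suc (len s)
  len-+generator s (inj₁ refl) = subst (λ z → len z ℕ.≤ suc (len s)) (sym (+-identityˡ s)) (ℕ.n≤1+n _)
  len-+generator s (inj₂ (i , inj₁ refl)) = subst (λ z → len z ℕ.≤ suc (len s)) (+-comm s _) (len-+pow i s)
  len-+generator s (inj₂ (i , inj₂ refl)) =
    subst₂ (λ u v → wl u ℕ.≤ suc (wl v))
           (trans (cong ∣_∣ (sym (neg-swap (+ (g ^ i)) s))) (∣-i∣≡∣i∣ (- (+ (g ^ i)) + s)))
           (∣-i∣≡∣i∣ s) (len-+pow i (- s))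

  len-lower : ∀ {r n} → SumOf g r n → len n ℕ.≤ r
  len-lower (xs , refl , xs∈A , refl) = by-induction xs xs∈A
    where
    by-induction : ∀ xs → All (InA g) xs → len (foldr _+_ 0ℤ xs) ℕ.≤ length xs
    by-induction []       []            = z≤n
    by-induction (x ∷ xs) (x∈A ∷ xs∈A) = ℕ.≤-trans (len-+generator _ x∈A) (s≤s (by-induction xs xs∈A))

  g*q≡ : ∀ q → + g * + q ≡ + (q ℕ.* g)
  g*q≡ q = trans (sym (pos-* g q)) (cong +_ (ℕ.*-comm g q))

  -- r + q g  =  -(g - r) + g (q + 1), the value of the second option of digitCost.
  borrow : ∀ r q → r ℕ.≤ g → - + (g ∸ r) + + g * + suc q ≡ + (r ℕ.+ q ℕ.* g)
  borrow r q r≤g = begin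
    - + D + + g * + suc q             ≡⟨ cong (λ k → - + D + k) (g*q≡ (suc q)) ⟩
    - + D + + (g ℕ.+ q ℕ.* g)         ≡⟨ cong (λ k → - + D + + k) g+qg≡ ⟩
    - + D + + (r ℕ.+ q ℕ.* g ℕ.+ D)   ≡⟨ cong (λ k → - + D + k) (pos-+ (r ℕ.+ q ℕ.* g) D) ⟩
    - + D + (+ (r ℕ.+ q ℕ.* g) + + D) ≡⟨ cancel (+ D) (+ (r ℕ.+ q ℕ.* g)) ⟩
    + (r ℕ.+ q ℕ.* g)                 ∎
    where
    open ≡-Reasoning
    D = g ∸ r
    move-D : ∀ r q D → (r ℕ.+ D) ℕ.+ q ℕ.* (r ℕ.+ D) ≡ r ℕ.+ q ℕ.* (r ℕ.+ D) ℕ.+ D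
    move-D = ℕ-Solver.solve-∀
    g+qg≡ : g ℕ.+ q ℕ.* g ≡ r ℕ.+ q ℕ.* g ℕ.+ D
    g+qg≡ = subst (λ G → G ℕ.+ q ℕ.* G ≡ r ℕ.+ q ℕ.* G ℕ.+ D) (ℕ.m+[n∸m]≡n r≤g) (move-D r q D)
    cancel : ∀ d x → - d + (x + d) ≡ x
    cancel = ℤ-Solver.solve-∀

  digitCost-represent : ∀ r q → r ℕ.< g → SumOf g (wl q) (+ q) →
                        (0 ℕ.< r → SumOf g (wl (suc q)) (+ suc q)) →
                        SumOf g (digitCost r (wl q) (wl (suc q))) (+ (r ℕ.+ q ℕ.* g))
  digitCost-represent zero    q _   Sq _ = subst (SumOf g (wl q)) (g*q≡ q) (sum-scale Sq)
  digitCost-represent (suc d) q r<g Sq Sq+1 with (suc d ℕ.+ wl q) ℕ.≤? ((g ∸ suc d) ℕ.+ wl (suc q))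
  ... | yes first≤ =
    subst₂ (SumOf g) (sym (ℕ.m≤n⇒m⊓n≡m first≤))
           (trans (cong (λ k → + suc d + k) (g*q≡ q)) (sym (pos-+ (suc d) _)))
           (sum-++ (sum-ones (suc d)) (sum-scale Sq))
  ... | no  first≰ =
    subst₂ (SumOf g) (sym (ℕ.m≥n⇒m⊓n≡n (ℕ.<⇒≤ (ℕ.≰⇒> first≰))))
           (borrow (suc d) q (ℕ.<⇒≤ r<g))
           (sum-++ (sum-neg (sum-ones (g ∸ suc d))) (sum-scale (Sq+1 (s≤s z≤n))))

  represent-small : ∀ n → n ℕ.< 2 → SumOf g (wl n) (+ n)
  represent-small zero       _ = sum-[]
  represent-small (suc zero) _ = sum-ones 1
  represent-small (suc (suc n)) (s≤s (s≤s ()))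

  wl-represent : ∀ n → SumOf g (wl n) (+ n)
  wl-represent = <-rec _ step
    where
    step : ∀ n → (∀ {m} → m ℕ.< n → SumOf g (wl m) (+ m)) → SumOf g (wl n) (+ n)
    step n ih with digitsOf n
    ... | digits r q r<g with 2 ℕ.≤? r ℕ.+ q ℕ.* g
    ...   | no  n≱2 = represent-small _ (ℕ.≰⇒> n≱2)
    ...   | yes n≥2 =
      subst (λ k → SumOf g k (+ (r ℕ.+ q ℕ.* g))) (sym (wl-digit r q r<g))
            (digitCost-represent r q r<g (ih (quot< r q (ℕ.<-trans (s≤s z≤n) n≥2)))
                                         (λ r>0 → ih (quot+1< r q r>0 n≥2)))

  len-represent : ∀ n → SumOf g (len n) n
  len-represent (+ n)    = wl-represent n
  len-represent -[1+ n ] = sum-neg (wl-represent (suc n))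

  len-subadditive : ∀ x y → len (x + y) ℕ.≤ len x ℕ.+ len y
  len-subadditive x y = len-lower (sum-++ (len-represent x) (len-represent y))

  len-zero : ∀ n → len n ≡ 0 → n ≡ 0ℤ
  len-zero n len≡0 = sum-zero (subst (λ k → SumOf g k n) len≡0 (len-represent n))

  wl-positive : ∀ n → 0 ℕ.< n → 0 ℕ.< wl n
  wl-positive n n>0 = ℕ.n≢0⇒n>0 λ wl≡0 → ℕ.>⇒≢ n>0 (+-injective (len-zero (+ n) wl≡0))

  len-word-length : ∀ n → WordLength g n (len n)
  len-word-length n with n ≟ 0ℤ
  ... | yes refl = inj₁ (refl , refl)
  ... | no  n≢0 =
    inj₂ (n≢0 , ℕ.n≢0⇒n>0 (λ len≡0 → n≢0 (len-zero n len≡0)) , len-represent n ,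
          λ r _ r<len Sr → ℕ.<⇒≱ r<len (len-lower Sr))

  -- Going down along a geodesic: if ℓ(n) = m + s, cutting a shortest word for n
  -- after m letters gives y with ℓ(y) = m and d(n, y) ≤ s.
  descend : ∀ m s n → len n ≡ m ℕ.+ s → Σ[ y ∈ ℤ ] len y ≡ m × len (n - y) ℕ.≤ s
  descend m s n len≡ with sum-split m s (subst (λ k → SumOf g k n) len≡ (len-represent n))
  ... | y , w , Sy , Sw , refl =
    y , ℕ.≤-antisym (len-lower Sy) m≤len-y , subst (λ v → len v ℕ.≤ s) (sym (cancel y w)) (len-lower Sw)
    where
    cancel : ∀ y w → y + w - y ≡ w
    cancel = ℤ-Solver.solve-∀
    m≤len-y : m ℕ.≤ len y
    m≤len-y = ℕ.+-cancelʳ-≤ s m (len y) (begin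
      m ℕ.+ s            ≡⟨ sym len≡ ⟩
      len (y + w)        ≤⟨ len-subadditive y w ⟩
      len y ℕ.+ len w    ≤⟨ ℕ.+-monoʳ-≤ (len y) (len-lower Sw) ⟩
      len y ℕ.+ s        ∎)
      where open ℕ.≤-Reasoning

-- For even g = 2 * half the spheres can always be left outwards: adding
-- g ^ (K + 1) to any n ≤ half * g ^ K raises wl by exactly one.
module EvenBase (t : ℕ) where

  open import Data.Nat as ℕ using (zero; suc; z≤n; s≤s; _∸_; _^_; _⊓_)
  import Data.Nat.Properties as ℕ
  open import Data.Integer using (ℤ; +_; -[1+_]; -_; _+_; _-_; ∣_∣)
  open import Data.Integer.Properties using (∣-i∣≡∣i∣; +-inverseʳ; neg-distrib-+)
  import Data.Integer.Tactic.RingSolver as ℤ-Solver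
  open import Data.Product using (Σ-syntax; _×_; _,_; proj₁)
  open import Data.Sum using (inj₁; inj₂)
  open import Relation.Nullary using (yes; no)
  open import Relation.Binary.PropositionalEquality
  open WordLengthFunction (t ℕ.+ t)
  open WordLengthLipschitz (t ℕ.+ t)
  open GeneratorSums g
  open IntegerWordLength (t ℕ.+ t)

  half : ℕ
  half = suc t

  half+half≡g : half ℕ.+ half ≡ g
  half+half≡g = cong suc (ℕ.+-suc t t)

  digitCost-suc : ∀ r a b → digitCost r (suc a) (suc b) ≡ suc (digitCost r a b)
  digitCost-suc zero    a b = refl
  digitCost-suc (suc d) a b = cong₂ _⊓_ (ℕ.+-suc (suc d) a) (ℕ.+-suc (g ∸ suc d) b)

  digitCost-mono : ∀ r {a a' b b'} → a ℕ.≤ a' → (0 ℕ.< r → b ℕ.≤ b') →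
                   digitCost r a b ℕ.≤ digitCost r a' b'
  digitCost-mono zero    a≤a' _    = a≤a'
  digitCost-mono (suc d) a≤a' b≤b' =
    ℕ.⊓-mono-≤ (ℕ.+-monoʳ-≤ (suc d) a≤a') (ℕ.+-monoʳ-≤ (g ∸ suc d) (b≤b' (s≤s z≤n)))

  -- The one-digit case of the jump: for a digit n ≤ half, wl (n + g) > wl n.
  -- Both options for n + g cost at least n + 1, the second because g - n ≥ n.
  jump-digit : ∀ n → n ℕ.+ n ℕ.≤ g → suc (digitCost n 0 1) ℕ.≤ digitCost n 1 (wl 2)
  jump-digit zero    _       = ℕ.≤-refl
  jump-digit (suc d) n+n≤g =
    ℕ.⊓-glb (ℕ.≤-trans bound (ℕ.≤-reflexive (ℕ.+-comm 1 (suc d))))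
            (ℕ.≤-trans bound (ℕ.≤-trans (s≤s (ℕ.m+n≤o⇒m≤o∸n (suc d) n+n≤g)) second≥))
    where
    bound : suc ((suc d ℕ.+ 0) ⊓ ((g ∸ suc d) ℕ.+ 1)) ℕ.≤ suc (suc d)
    bound = s≤s (ℕ.≤-trans (ℕ.m⊓n≤m _ _) (ℕ.≤-reflexive (ℕ.+-identityʳ _)))
    second≥ : suc (g ∸ suc d) ℕ.≤ (g ∸ suc d) ℕ.+ wl 2
    second≥ = ℕ.≤-trans (ℕ.≤-reflexive (ℕ.+-comm 1 (g ∸ suc d)))
                        (ℕ.+-monoʳ-≤ (g ∸ suc d) (wl-positive 2 (s≤s z≤n)))

  scale-assoc : ∀ K → half ℕ.* (g ℕ.* g ^ K) ≡ half ℕ.* g ^ K ℕ.* g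
  scale-assoc K = trans (cong (half ℕ.*_) (ℕ.*-comm g (g ^ K))) (sym (ℕ.*-assoc half (g ^ K) g))

  wl-jump : ∀ K n → n ℕ.≤ half ℕ.* g ^ K → suc (wl n) ℕ.≤ wl (n ℕ.+ g ^ suc K)
  wl-jump zero    n n≤half = subst₂ (λ u v → suc u ℕ.≤ v) (sym wl-n) (sym wl-n+g) (jump-digit n n+n≤g)
    where
    n≤half' : n ℕ.≤ half
    n≤half' = subst (n ℕ.≤_) (ℕ.*-identityʳ half) n≤half
    n+n≤g : n ℕ.+ n ℕ.≤ g
    n+n≤g = subst (n ℕ.+ n ℕ.≤_) half+half≡g (ℕ.+-mono-≤ n≤half' n≤half')
    n<g : n ℕ.< g
    n<g = ℕ.≤-<-trans n≤half' (subst (half ℕ.<_) half+half≡g (ℕ.m<m+n half (s≤s z≤n)))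
    wl-n : wl n ≡ digitCost n 0 1
    wl-n = trans (cong wl (sym (ℕ.+-identityʳ n))) (wl-digit n 0 n<g)
    wl-n+g : wl (n ℕ.+ g ^ 1) ≡ digitCost n 1 (wl 2)
    wl-n+g = trans (cong (λ k → wl (n ℕ.+ k)) (ℕ.*-comm g 1)) (wl-digit n 1 n<g)
  wl-jump (suc K) n n≤bound with digitsOf n
  ... | digits r q r<g = begin
    suc (wl (r ℕ.+ q ℕ.* g))
      ≡⟨ cong suc (wl-digit r q r<g) ⟩
    suc (digitCost r (wl q) (wl (suc q)))
      ≡⟨ sym (digitCost-suc r _ _) ⟩
    digitCost r (suc (wl q)) (suc (wl (suc q)))
      ≤⟨ digitCost-mono r (wl-jump K q q≤) (λ r>0 → wl-jump K (suc q) (q<m r>0)) ⟩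
    digitCost r (wl (q ℕ.+ g ^ suc K)) (wl (suc q ℕ.+ g ^ suc K))
      ≡⟨ sym (wl-digit r (q ℕ.+ g ^ suc K) r<g) ⟩
    wl (r ℕ.+ (q ℕ.+ g ^ suc K) ℕ.* g)
      ≡⟨ cong wl (sym (add-to-quotient r q (g ^ suc K))) ⟩
    wl (r ℕ.+ q ℕ.* g ℕ.+ g ^ suc (suc K))  ∎
    where
    open ℕ.≤-Reasoning
    n≤mg : r ℕ.+ q ℕ.* g ℕ.≤ half ℕ.* g ^ K ℕ.* g
    n≤mg = ℕ.≤-trans n≤bound (ℕ.≤-reflexive (scale-assoc K))
    q≤ : q ℕ.≤ half ℕ.* g ^ K
    q≤ = quot-≤ (half ℕ.* g ^ K) n≤mg
    q<m : 0 ℕ.< r → q ℕ.< half ℕ.* g ^ K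
    q<m r>0 = quot-< (half ℕ.* g ^ K) r>0 n≤mg

  -- With the Lipschitz bound the jump is exactly one.
  wl-jump-exact : ∀ K n → n ℕ.≤ half ℕ.* g ^ K → wl (n ℕ.+ g ^ suc K) ≡ suc (wl n)
  wl-jump-exact K n n≤ = ℕ.≤-antisym (proj₁ (wl-+pow-≈₁ (suc K) n)) (wl-jump K n n≤)

  -- Every n satisfies the hypothesis of the jump for K = n.
  n<g^n : ∀ n → n ℕ.< g ^ n
  n<g^n zero    = s≤s z≤n
  n<g^n (suc n) = begin-strict
    suc n                  <⟨ ℕ.+-mono-≤ (ℕ.≤-trans (s≤s z≤n) (n<g^n n)) (n<g^n n) ⟩
    g ^ n ℕ.+ g ^ n        ≡⟨ cong (g ^ n ℕ.+_) (sym (ℕ.+-identityʳ (g ^ n))) ⟩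
    2 ℕ.* g ^ n            ≤⟨ ℕ.*-monoˡ-≤ (g ^ n) 1<g ⟩
    g ^ suc n              ∎
    where open ℕ.≤-Reasoning

  n≤half*g^n : ∀ n → n ℕ.≤ half ℕ.* g ^ n
  n≤half*g^n n = ℕ.≤-trans (ℕ.<⇒≤ (n<g^n n)) (ℕ.m≤n*m (g ^ n) half)

  -- Every integer z has a generator x with ℓ(z + x) = ℓ(z) + 1: push |z| away
  -- from 0 by a power of g large enough for wl-jump.
  ascend-one : ∀ z → Σ[ x ∈ ℤ ] InA g x × len (z + x) ≡ suc (len z)
  ascend-one (+ a)    = + (g ^ suc a) , inj₂ (suc a , inj₁ refl) , wl-jump-exact a a (n≤half*g^n a)
  ascend-one -[1+ a ] =
    - + (g ^ suc (suc a)) , inj₂ (suc (suc a) , inj₂ refl) ,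
    trans (cong wl ∣z+x∣≡) (wl-jump-exact (suc a) (suc a) (n≤half*g^n (suc a)))
    where
    ∣z+x∣≡ : ∣ - + suc a + - + (g ^ suc (suc a)) ∣ ≡ suc a ℕ.+ g ^ suc (suc a)
    ∣z+x∣≡ = trans (cong ∣_∣ (sym (neg-distrib-+ (+ suc a) (+ (g ^ suc (suc a))))))
                   (∣-i∣≡∣i∣ (+ suc a + + (g ^ suc (suc a))))

  ascend : ∀ s n → Σ[ z ∈ ℤ ] len z ≡ len n ℕ.+ s × len (n - z) ℕ.≤ s
  ascend zero    n = n , sym (ℕ.+-identityʳ _) , ℕ.≤-reflexive (cong len (+-inverseʳ n))
  ascend (suc s) n with ascend s n
  ... | z , len-z≡ , dist≤ with ascend-one z
  ... | x , x∈A , len-z+x≡ =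
    z + x , trans len-z+x≡ (trans (cong suc len-z≡) (sym (ℕ.+-suc _ s))) ,
    subst (λ v → len v ℕ.≤ suc s) (sym (split-off n z x))
          (ℕ.≤-trans (len-+generator (n - z) (inA-neg x∈A)) (s≤s dist≤))
    where
    split-off : ∀ n z x → n - (z + x) ≡ - x + (n - z)
    split-off = ℤ-Solver.solve-∀

  -- Every n is within distance h of a point whose length is a multiple of 2h + 1:
  -- write ℓ(n) = q (2h + 1) + r and descend r steps if r ≤ h, else ascend 2h + 1 - r.
  net-point : ∀ h n → Σ[ z ∈ ℤ ] Σ[ q ∈ ℕ ] len z ≡ (2 ℕ.* h ℕ.+ 1) ℕ.* q × len (n - z) ℕ.≤ h
  net-point h n = by-digits (N-ary.digitsOf (len n)) refl
    where
    N : ℕ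
    N = suc (2 ℕ.* h)
    N≡ : N ≡ 2 ℕ.* h ℕ.+ 1
    N≡ = ℕ.+-comm 1 (2 ℕ.* h)
    module N-ary = BaseExpansion N
    by-digits : ∀ {ℓ} → N-ary.Digits ℓ → len n ≡ ℓ →
                Σ[ z ∈ ℤ ] Σ[ q ∈ ℕ ] len z ≡ (2 ℕ.* h ℕ.+ 1) ℕ.* q × len (n - z) ℕ.≤ h
    by-digits (N-ary.digits r q r<N) len≡ with r ℕ.≤? h
    ... | yes r≤h with descend (q ℕ.* N) r n (trans len≡ (ℕ.+-comm r (q ℕ.* N)))
    ...   | y , len-y≡ , dist≤ =
      y , q , trans len-y≡ (trans (ℕ.*-comm q N) (cong (ℕ._* q) N≡)) , ℕ.≤-trans dist≤ r≤h
    by-digits (N-ary.digits r q r<N) len≡ | no r≰h with ascend (N ∸ r) n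
    ...   | z , len-z≡ , dist≤ =
      z , suc q , trans len-z≡ (trans (cong (ℕ._+ (N ∸ r)) len≡) round-up) , ℕ.≤-trans dist≤ N-r≤h
      where
      N-r≤h : N ∸ r ℕ.≤ h
      N-r≤h = ℕ.≤-trans (ℕ.∸-monoʳ-≤ N (ℕ.≰⇒> r≰h))
                        (ℕ.≤-reflexive (trans (ℕ.m+n∸m≡n h (h ℕ.+ 0)) (ℕ.+-identityʳ h)))
      round-up : r ℕ.+ q ℕ.* N ℕ.+ (N ∸ r) ≡ (2 ℕ.* h ℕ.+ 1) ℕ.* suc q
      round-up = begin
        r ℕ.+ q ℕ.* N ℕ.+ (N ∸ r)   ≡⟨ ℕ.+-assoc r _ _ ⟩
        r ℕ.+ (q ℕ.* N ℕ.+ (N ∸ r)) ≡⟨ cong (r ℕ.+_) (ℕ.+-comm (q ℕ.* N) (N ∸ r)) ⟩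
        r ℕ.+ ((N ∸ r) ℕ.+ q ℕ.* N) ≡⟨ sym (ℕ.+-assoc r _ _) ⟩
        r ℕ.+ (N ∸ r) ℕ.+ q ℕ.* N   ≡⟨ cong (ℕ._+ q ℕ.* N) (ℕ.m+[n∸m]≡n (ℕ.<⇒≤ r<N)) ⟩
        suc q ℕ.* N                 ≡⟨ ℕ.*-comm (suc q) N ⟩
        N ℕ.* suc q                 ≡⟨ cong (ℕ._* suc q) N≡ ⟩
        (2 ℕ.* h ℕ.+ 1) ℕ.* suc q   ∎
        where open ≡-Reasoning

  is-net : ∀ h → IsNet g h (CSet g h)
  is-net h n with net-point h n
  ... | z , q , len-z≡ , dist≤ =
    z , (q , subst (WordLength g z) len-z≡ (len-word-length z)) ,
    len (n - z) , dist≤ , len-word-length (n - z)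

module Evenness where

  open import Data.Nat
  open import Data.Nat.Properties using (*-comm; +-identityʳ; >⇒≢)
  open import Data.Nat.Divisibility using (divides; m%n≡0⇒n∣m)
  open import Data.Product using (Σ-syntax; _,_)
  open import Relation.Nullary using (contradiction)
  open import Relation.Binary.PropositionalEquality

  even-positive : ∀ g → 0 < g → g % 2 ≡ 0 → Σ[ t ∈ ℕ ] g ≡ suc (suc (t + t))
  even-positive g g>0 g%2≡0 with m%n≡0⇒n∣m g 2 g%2≡0
  ... | divides zero    g≡0 = contradiction g≡0 (>⇒≢ g>0)
  ... | divides (suc t) g≡  = t , trans g≡ (cong (λ k → suc (suc k)) t*2≡t+t)
    where
    t*2≡t+t : t * 2 ≡ t + t
    t*2≡t+t = trans (*-comm t 2) (cong (t +_) (+-identityʳ t))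

open Evenness using (even-positive)

mainTheorem6 : (g : ℕ) → 0 < g → g % 2 ≡ 0 → (h : ℕ) → IsNet g h (CSet g h)
mainTheorem6 g g>0 g-even h with even-positive g g>0 g-even
... | t , refl = EvenBase.is-net t h
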